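{- Let $s\in\Omega^G$ and let $\tilde B,\tilde B'$ be Borel subgroups of $\tilde G$ containing $M_{\tilde0}$ and $B$. Then $$s(\hat\Delta_{\tilde B}\setminus\hat\Delta_{\tilde B'})\cap\hat\Delta_{\tilde B'}=\emptyset.$$
   Context: Let $W$ be a vector space over a number field $F$ with basis $e_0,\dots,e_n$, $V=\mathrm{span}(e_1,\dots,e_n)$, $\tilde G=GL(W)$ and $G=GL(V)$ embedded in $\tilde G$ as the subgroup stabilizing $V$ and fixing $e_0$. $M_{\tilde0}$ is the diagonal torus of $\tilde G$, $M_0=M_{\tilde 0}\cap G$, $B$ a Borel subgroup of $G$ containing $M_0$. The Weyl group $\Omega^{\tilde G}$ of $(\tilde G,M_{\tilde0})$ is identified with the permutations of $\{e_0,\dots,e_n\}$, and $\Omega^G\subseteq\Omega^{\tilde G}$ with those fixing $e_0$; it acts on $(\mathfrak a_{\tilde 0}^{\tilde G})^*$, where $\mathfrak a_{\tilde0}=\mathrm{Hom}(X^*(M_{\tilde 0}),\mathbb R)$. For a Borel subgroup $\tilde B\supseteq M_{\tilde 0}$ of $\tilde G$, $\hat\Delta_{\tilde B}\subset(\mathfrak a_{\tilde 0}^{\tilde G})^*$ is the set of fundamental weights attached to $\tilde B$. -}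

module Defs where

open import Data.Nat using (ℕ; zero; suc)
open import Data.Fin using (Fin; zero; suc; toℕ; _<_)
open import Data.Fin.Permutation using (Permutation′; _⟨$⟩ʳ_; _⟨$⟩ˡ_)
open import Data.Integer using (+_)
open import Data.Rational using (ℚ; _/_; _-_; 0ℚ; 1ℚ)
open import Data.Product using (Σ; ∃)
open import Relation.Nullary using (¬_; yes; no)
open import Relation.Binary.PropositionalEquality using (_≡_)
import Data.Nat as N

-- Coordinates on a_0^* w.r.t. the dual basis e_0^*,...,e_n^* (indices Fin (suc n)).
-- (a_0^{G~})^* is the sum-zero subspace; weights are ℚ-valued (all weights involved are rational).
Weight : ℕ → Set
Weight n = Fin (suc n) → ℚ

-- A Borel subgroup of G~ = GL(W) containing the diagonal torus M_0~ is the stabiliser of a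
-- coordinate flag  <e_{σ 0}> ⊂ <e_{σ 0}, e_{σ 1}> ⊂ ... ; we represent it by σ : position ↦ index.
BorelG~ : ℕ → Set
BorelG~ n = Permutation′ (suc n)

pos : ∀ {n} → BorelG~ n → Fin (suc n) → Fin (suc n)
pos σ i = σ ⟨$⟩ˡ i

-- A Borel subgroup B of G = GL(V) containing M_0: τ : position ↦ index, where index j : Fin n
-- stands for the basis vector e_{j+1} of V.
BorelG : ℕ → Set
BorelG n = Permutation′ n

-- B ⊆ B~ : every positive root of B (e_{τ a} before e_{τ b}, a < b) is a positive root of B~.
Contains : ∀ {n} → BorelG~ n → BorelG n → Set
Contains {n} σ τ = ∀ (a b : Fin n) → a < b → pos σ (suc (τ ⟨$⟩ʳ a)) < pos σ (suc (τ ⟨$⟩ʳ b))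

-- The k-th fundamental weight (k ∈ {1..n} encoded as k' : Fin n, k = k'+1) of B~:
-- projection to the sum-zero subspace of  e_{σ 0}^* + ... + e_{σ (k-1)}^*,
-- i.e. coordinate i equals [pos σ i < k] - k/(n+1).
fundWeight : ∀ {n} → BorelG~ n → Fin n → Weight n
fundWeight {n} σ k i with toℕ (pos σ i) N.≤? toℕ k
... | yes _ = 1ℚ - (+ (suc (toℕ k)) / suc n)
... | no  _ = 0ℚ - (+ (suc (toℕ k)) / suc n)

_∈Δ̂_ : ∀ {n} → Weight n → BorelG~ n → Set
_∈Δ̂_ {n} λ' σ = ∃ λ (k : Fin n) → ∀ i → λ' i ≡ fundWeight σ k i

WeylG : ℕ → Set
WeylG n = Σ (Permutation′ (suc n)) (λ s → s ⟨$⟩ʳ zero ≡ zero)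

-- action of a permutation s (e_i ↦ e_{s i}) on weights: (s λ)(e_{s i}) = λ(e_i)
act : ∀ {n} → Permutation′ (suc n) → Weight n → Weight n
act s λ' i = λ' (s ⟨$⟩ˡ i)

{-# OPTIONS --safe #-}
-- Writing the fundamental weight ϖ_k of a flag σ as 𝟙_{P} − (k+1)/(n+1), where P is the set of
-- basis vectors among the first k+1 of the flag, an equality s ϖ_k(σ) = ϖ_k'(σ') forces k = k'
-- and s(P) = P'. As s fixes e_0 and permutes e_1,…,e_n, the sets P ∩ V and P' ∩ V have the same
-- size; both are initial segments for the order of B, because σ and σ' contain B, so they agree,
-- and P = P'. Hence ϖ_k(σ) = ϖ_k(σ') ∈ Δ̂_{σ'}.
module Submission where

open import Defs
open import Data.Nat using (ℕ)
open import Data.Product using (proj₁)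
open import Relation.Nullary using (¬_)

open import Data.Bool using (Bool; true; false; T)
open import Data.Empty using (⊥-elim)
open import Data.Fin using (Fin; zero; suc; toℕ; _<_)
open import Data.Fin.Permutation as Perm using (Permutation′; _⟨$⟩ʳ_; _⟨$⟩ˡ_)
open import Data.Fin.Properties using (toℕ-injective; toℕ<n)
open import Data.Integer as ℤ using (+_)
import Data.Integer.Properties as ℤ
import Data.Nat as ℕ
import Data.Nat.Properties as ℕ
open import Data.Product using (_×_; _,_)
open import Data.Rational using (ℚ; _/_; _-_; -_; _≤_; 0ℚ; 1ℚ)
  renaming (_<_ to _<ℚ_)
open import Data.Rational.Properties
  using ( +-0-group; +-inverseʳ; +-identityˡ; +-monoˡ-≤; neg-injective; neg-antimono-<
        ; <-irrefl; <-≤-trans; normalize-injective-≃; normalize-pos; positive⁻¹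
        ; toℚᵘ-fromℚᵘ; toℚᵘ-cancel-≤)
import Data.Rational.Unnormalised as ℚᵘ
import Data.Rational.Unnormalised.Properties as ℚᵘ
open import Function using (_∘_)
open import Relation.Binary.PropositionalEquality
open import Relation.Nullary using (does; yes; no)
open import Relation.Nullary.Decidable using (dec-true; dec-false)

open import Algebra.Properties.CommutativeMonoid.Sum ℕ.+-0-commutativeMonoid
  using (sum; sum-permute; sum-cong-≗; sum-replicate-zero)
open import Algebra.Properties.Group +-0-group using (∙-cancelˡ)

indicatorℕ : Bool → ℕ
indicatorℕ true  = 1
indicatorℕ false = 0

count : ∀ {m} → (Fin m → Bool) → ℕ
count D = sum (indicatorℕ ∘ D)

count-permute : ∀ {m} (D : Fin m → Bool) (π : Permutation′ m) → count D ≡ count (D ∘ (π ⟨$⟩ʳ_))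
count-permute D = sum-permute (indicatorℕ ∘ D)

count-allFalse : ∀ {m} (D : Fin m → Bool) → (∀ a → D a ≡ false) → count D ≡ 0
count-allFalse {m} D D≗false = trans (sum-cong-≗ (cong indicatorℕ ∘ D≗false)) (sum-replicate-zero m)

DownClosed : ∀ {m} → (Fin m → Bool) → Set
DownClosed D = ∀ {a b} → a < b → T (D b) → T (D a)

downClosed-head-false : ∀ {m} {D : Fin (ℕ.suc m) → Bool} →
  DownClosed D → D zero ≡ false → ∀ b → D b ≡ false
downClosed-head-false closed D0≡false zero = D0≡false
downClosed-head-false {D = D} closed D0≡false (suc b) with D (suc b) in Db
... | false = refl
... | true  = ⊥-elim (subst T D0≡false (closed ℕ.z<s (subst T (sym Db) _)))

downClosed⇒≡<ᵇcount : ∀ {m} {D : Fin m → Bool} → DownClosed D → ∀ a → D a ≡ (toℕ a ℕ.<ᵇ count D)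
downClosed⇒≡<ᵇcount {ℕ.suc m} {D} closed a with D zero in D0
... | false = trans (downClosed-head-false closed D0 a)
                    (cong (toℕ a ℕ.<ᵇ_) (sym (count-allFalse (D ∘ suc) (downClosed-head-false closed D0 ∘ suc))))
... | true with a
...   | zero   = D0
...   | suc a′ = downClosed⇒≡<ᵇcount (λ a<b → closed (ℕ.s<s a<b)) a′

downClosed-unique : ∀ {m} {D E : Fin m → Bool} → DownClosed D → DownClosed E → count D ≡ count E → ∀ a → D a ≡ E a
downClosed-unique closedD closedE counts a =
  trans (downClosed⇒≡<ᵇcount closedD a)
        (trans (cong (toℕ a ℕ.<ᵇ_) counts) (sym (downClosed⇒≡<ᵇcount closedE a)))

downClosed-unique-along : ∀ {m} {D E : Fin m → Bool} (τ : Permutation′ m) →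
  DownClosed (D ∘ (τ ⟨$⟩ʳ_)) → DownClosed (E ∘ (τ ⟨$⟩ʳ_)) → count D ≡ count E → ∀ a → D a ≡ E a
downClosed-unique-along {D = D} {E} τ closedD closedE counts a =
  subst (λ b → D b ≡ E b) (Perm.inverseʳ τ) (downClosed-unique closedD closedE countsAlong (τ ⟨$⟩ˡ a))
  where
  countsAlong : count (D ∘ (τ ⟨$⟩ʳ_)) ≡ count (E ∘ (τ ⟨$⟩ʳ_))
  countsAlong = trans (sym (count-permute D τ)) (trans counts (count-permute E τ))

downClosed-permute-unique : ∀ {m} (D E : Fin (ℕ.suc m) → Bool) (π : Permutation′ (ℕ.suc m)) (τ : Permutation′ m) →
  π ⟨$⟩ʳ zero ≡ zero → DownClosed (D ∘ suc ∘ (τ ⟨$⟩ʳ_)) → DownClosed (E ∘ suc ∘ (τ ⟨$⟩ʳ_)) →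
  (∀ a → D (π ⟨$⟩ˡ a) ≡ E a) → ∀ a → D a ≡ E a
downClosed-permute-unique D E π τ π0≡0 closedD closedE D∘π⁻¹≗E = equal
  where
  heads : D zero ≡ E zero
  heads = trans (cong D (sym (trans (cong (π ⟨$⟩ˡ_) (sym π0≡0)) (Perm.inverseˡ π)))) (D∘π⁻¹≗E zero)

  counts : count D ≡ count E
  counts = trans (count-permute D (Perm.flip π)) (sum-cong-≗ (cong indicatorℕ ∘ D∘π⁻¹≗E))

  tails : count (D ∘ suc) ≡ count (E ∘ suc)
  tails = ℕ.+-cancelˡ-≡ (indicatorℕ (D zero)) _ _
            (trans counts (cong (λ b → indicatorℕ b ℕ.+ count (E ∘ suc)) (sym heads)))

  equal : ∀ a → D a ≡ E a
  equal zero    = heads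
  equal (suc a) = downClosed-unique-along τ closedD closedE tails a

flagPrefix : ∀ {n} → BorelG~ n → ℕ → Fin (ℕ.suc n) → Bool
flagPrefix σ m i = does (toℕ (pos σ i) ℕ.≤? m)

contains⇒downClosed : ∀ {n} (σ : BorelG~ n) (τ : BorelG n) → Contains σ τ →
  ∀ m → DownClosed (flagPrefix σ m ∘ suc ∘ (τ ⟨$⟩ʳ_))
contains⇒downClosed σ τ σ⊇τ m {a} {b} a<b b∈prefix =
  ℕ.≤⇒≤ᵇ (ℕ.≤-trans (ℕ.<⇒≤ (σ⊇τ a b a<b)) (ℕ.≤ᵇ⇒≤ (position b) m b∈prefix))
  where
  position : Fin _ → ℕ
  position c = toℕ (pos σ (suc (τ ⟨$⟩ʳ c)))

indicator : Bool → ℚ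
indicator true  = 1ℚ
indicator false = 0ℚ

fundCoeff : ∀ n → Fin n → ℚ
fundCoeff n k = + ℕ.suc (toℕ k) / ℕ.suc n

fundWeight≡indicator-fundCoeff : ∀ {n} (σ : BorelG~ n) k i →
  fundWeight σ k i ≡ indicator (flagPrefix σ (toℕ k) i) - fundCoeff n k
-- The goal mentions `flagPrefix`, which has already reduced to `_≤ᵇ_` and so is not abstracted.
fundWeight≡indicator-fundCoeff {n} σ k i with toℕ (pos σ i) ℕ.≤? toℕ k
... | yes p = cong (λ b → indicator b - fundCoeff n k) (sym (dec-true (toℕ (pos σ i) ℕ.≤? toℕ k) p))
... | no ¬p = cong (λ b → indicator b - fundCoeff n k) (sym (dec-false (toℕ (pos σ i) ℕ.≤? toℕ k) ¬p))

fundCoeff-injective : ∀ {n} {k k′ : Fin n} → fundCoeff n k ≡ fundCoeff n k′ → k ≡ k′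
fundCoeff-injective {n} {k} {k′} eq = toℕ-injective (ℕ.suc-injective (ℕ.*-cancelʳ-≡ _ _ (ℕ.suc n)
  (normalize-injective-≃ (ℕ.suc (toℕ k)) (ℕ.suc (toℕ k′)) (ℕ.suc n) (ℕ.suc n) eq)))

fundCoeff-positive : ∀ n (k : Fin n) → 0ℚ <ℚ fundCoeff n k
fundCoeff-positive n k = positive⁻¹ (fundCoeff n k) {{normalize-pos (ℕ.suc (toℕ k)) (ℕ.suc n)}}

fundCoeff≤1 : ∀ n (k : Fin n) → fundCoeff n k ≤ 1ℚ
fundCoeff≤1 n k = toℚᵘ-cancel-≤ (ℚᵘ.≤-respˡ-≃ (ℚᵘ.≃-sym (toℚᵘ-fromℚᵘ c)) (ℚᵘ.*≤* k+1≤n+1))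
  where
  c = ℚᵘ.mkℚᵘ (+ ℕ.suc (toℕ k)) n
  k+1≤n+1 : + ℕ.suc (toℕ k) ℤ.* + 1 ℤ.≤ + 1 ℤ.* + ℕ.suc n
  k+1≤n+1 rewrite ℤ.*-identityʳ (+ ℕ.suc (toℕ k)) | ℤ.*-identityˡ (+ ℕ.suc n) =
    ℤ.+≤+ (ℕ.<⇒≤ (ℕ.s<s (toℕ<n k)))

-‿cancelˡ : ∀ x {y z} → x - y ≡ x - z → y ≡ z
-‿cancelˡ x eq = neg-injective (∙-cancelˡ x _ _ eq)

1-c≢0-c′ : ∀ {c c′} → c ≤ 1ℚ → 0ℚ <ℚ c′ → 1ℚ - c ≢ 0ℚ - c′
1-c≢0-c′ {c} {c′} c≤1 0<c′ eq = <-irrefl (sym eq) (<-≤-trans 0-c′<0 0≤1-c)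
  where
  0-c′<0 : 0ℚ - c′ <ℚ 0ℚ
  0-c′<0 = subst (_<ℚ 0ℚ) (sym (+-identityˡ (- c′))) (neg-antimono-< 0<c′)
  0≤1-c : 0ℚ ≤ 1ℚ - c
  0≤1-c = subst (_≤ 1ℚ - c) (+-inverseʳ c) (+-monoˡ-≤ (- c) c≤1)

indicator-sub-injective : ∀ {b b′ c c′} → 0ℚ <ℚ c → c ≤ 1ℚ → 0ℚ <ℚ c′ → c′ ≤ 1ℚ →
  indicator b - c ≡ indicator b′ - c′ → b ≡ b′ × c ≡ c′
indicator-sub-injective {true}  {true}  _   _   _    _    eq = refl , -‿cancelˡ 1ℚ eq
indicator-sub-injective {false} {false} _   _   _    _    eq = refl , -‿cancelˡ 0ℚ eq
indicator-sub-injective {true}  {false} _   c≤1 0<c′ _    eq = ⊥-elim (1-c≢0-c′ c≤1 0<c′ eq)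
indicator-sub-injective {false} {true}  0<c _   _    c′≤1 eq = ⊥-elim (1-c≢0-c′ c′≤1 0<c (sym eq))

fundWeight-coordinate-injective : ∀ {n} (σ σ′ : BorelG~ n) k k′ i i′ → fundWeight σ k i ≡ fundWeight σ′ k′ i′ →
  flagPrefix σ (toℕ k) i ≡ flagPrefix σ′ (toℕ k′) i′ × k ≡ k′
fundWeight-coordinate-injective {n} σ σ′ k k′ i i′ eq
  with indicator-sub-injective (fundCoeff-positive n k) (fundCoeff≤1 n k) (fundCoeff-positive n k′) (fundCoeff≤1 n k′)
         (trans (sym (fundWeight≡indicator-fundCoeff σ k i)) (trans eq (fundWeight≡indicator-fundCoeff σ′ k′ i′)))
... | prefixes , coeffs = prefixes , fundCoeff-injective coeffs

act-fundWeight-injective : ∀ {n} (s : Permutation′ (ℕ.suc n)) (σ σ′ : BorelG~ n) k k′ →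
  (∀ i → act s (fundWeight σ k) i ≡ fundWeight σ′ k′ i) →
  ∀ i → flagPrefix σ (toℕ k) (s ⟨$⟩ˡ i) ≡ flagPrefix σ′ (toℕ k) i
act-fundWeight-injective s σ σ′ k k′ eq with fundWeight-coordinate-injective σ σ′ k k′ _ zero (eq zero)
... | _ , refl = λ i → proj₁ (fundWeight-coordinate-injective σ σ′ k k _ i (eq i))

fundWeight-cong : ∀ {n} (σ σ′ : BorelG~ n) k → (∀ i → flagPrefix σ (toℕ k) i ≡ flagPrefix σ′ (toℕ k) i) →
  ∀ i → fundWeight σ k i ≡ fundWeight σ′ k i
fundWeight-cong {n} σ σ′ k prefixes i = begin
  fundWeight σ k i                                  ≡⟨ fundWeight≡indicator-fundCoeff σ k i ⟩
  indicator (flagPrefix σ (toℕ k) i) - fundCoeff n k  ≡⟨ cong (λ b → indicator b - fundCoeff n k) (prefixes i) ⟩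
  indicator (flagPrefix σ′ (toℕ k) i) - fundCoeff n k ≡⟨ fundWeight≡indicator-fundCoeff σ′ k i ⟨
  fundWeight σ′ k i                                 ∎
  where open ≡-Reasoning

lemma3p3 : (n : ℕ) (B : BorelG n) (s : WeylG n) (B~ B~' : BorelG~ n) →
    Contains B~ B → Contains B~' B →
    (λ' : Weight n) → λ' ∈Δ̂ B~ → ¬ (λ' ∈Δ̂ B~') → ¬ (act (proj₁ s) λ' ∈Δ̂ B~')
lemma3p3 n τ (s , s0≡0) σ σ′ σ⊇τ σ′⊇τ λ′ (k , λ′≗ϖk) λ′∉Δ̂σ′ (k′ , sλ′≗ϖ′k′) =
  λ′∉Δ̂σ′ (k , λ i → trans (λ′≗ϖk i) (fundWeight-cong σ σ′ k prefixes i))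
  where
  sϖk≗ϖ′k′ : ∀ i → act s (fundWeight σ k) i ≡ fundWeight σ′ k′ i
  sϖk≗ϖ′k′ i = trans (sym (λ′≗ϖk (s ⟨$⟩ˡ i))) (sλ′≗ϖ′k′ i)

  prefixes : ∀ i → flagPrefix σ (toℕ k) i ≡ flagPrefix σ′ (toℕ k) i
  prefixes = downClosed-permute-unique (flagPrefix σ (toℕ k)) (flagPrefix σ′ (toℕ k)) s τ s0≡0
    (contains⇒downClosed σ τ σ⊇τ (toℕ k)) (contains⇒downClosed σ′ τ σ′⊇τ (toℕ k))
    (act-fundWeight-injective s σ σ′ k k′ sϖk≗ϖ′k′)
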